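{- Fix $k\in\mathbb Z_{\ge0}$ and let $\psi$ be the map of the context. If $(X,Y,Z)$ is a $k$-MM triple, then $(\psi(X),\psi(Y),\psi(Z))$ is a $k$-GC triple. Conversely, if $(P,Q,R)$ is a $k$-GC triple, then $(\psi^{ -1}(P),\psi^{ -1}(Q),\psi^{ -1}(R))$ is a $k$-MM triple.
   Context: Fix $k\in\mathbb Z_{\ge0}$. A $k$-GM triple is $(a,b,c)\in\mathbb Z_{\ge1}^3$ with $a^2+b^2+c^2+k(bc+ca+ab)=(3+3k)abc$; a $k$-GM number is an entry of some $k$-GM triple. Let $S=\begin{bmatrix}k&0\\3k^2+3k&k\end{bmatrix}$ and $T=\begin{bmatrix}-1&0\\3k+3&-1\end{bmatrix}$. A $k$-GC matrix is $P\in SL(2,\mathbb Z)$ whose $(1,2)$-entry $p_{12}$ is a $k$-GM number and $\operatorname{tr}P=(3k+3)p_{12}-k$. A $k$-GC triple is a triple $(P,Q,R)$ of $k$-GC matrices with $Q=PR-S$ and $(p_{12},q_{12},r_{12})$ a $k$-GM triple ($(1,2)$-entries). A $k$-MM matrix is $X\in SL(2,\mathbb Z)$ whose $(1,2)$-entry is a $k$-GM number and $\operatorname{tr}X=-k$. A $k$-MM triple is a triple $(X,Y,Z)$ of $k$-MM matrices with $XYZ=T$ and $(x_{12},y_{12},z_{12})$ a $k$-GM triple. The bijection $\psi$ of $M(2,\mathbb Z)$ is \[\psi\begin{bmatrix} m_{11}&m_{12}\\ m_{21}&m_{22}\end{bmatrix}=\begin{bmatrix} -m_{11}+m_{12}k-k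 & m_{12}\\ m_{21}-(k+3)m_{11}+k(2k+3)(m_{12}-1) & -m_{22}+(2k+3)m_{12}-k\end{bmatrix}.\] -}

module Defs where

open import Data.Nat using (ℕ)
open import Data.Integer using (ℤ; +_; _+_; _-_; _*_; -_)
open import Data.Product using (Σ; _×_; ∃)
open import Relation.Binary.PropositionalEquality using (_≡_)

record M2 : Set where
  constructor mat
  field
    m11 m12 m21 m22 : ℤ
open M2 public

_⊗_ : M2 → M2 → M2
A ⊗ B = mat (m11 A * m11 B + m12 A * m21 B) (m11 A * m12 B + m12 A * m22 B)
            (m21 A * m11 B + m22 A * m21 B) (m21 A * m12 B + m22 A * m22 B)

_⊖_ : M2 → M2 → M2
A ⊖ B = mat (m11 A - m11 B) (m12 A - m12 B) (m21 A - m21 B) (m22 A - m22 B)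

det : M2 → ℤ
det A = m11 A * m22 A - m12 A * m21 A

tr : M2 → ℤ
tr A = m11 A + m22 A

InSL2 : M2 → Set
InSL2 A = det A ≡ + 1

module _ (k : ℕ) where
  private
    κ : ℤ
    κ = + k

  Pos : ℤ → Set
  Pos x = Σ ℕ (λ n → x ≡ + (Data.Nat.suc n))

  GMTriple : ℤ → ℤ → ℤ → Set
  GMTriple a b c = Pos a × Pos b × Pos c ×
    (a * a + b * b + c * c + κ * (b * c + c * a + a * b)
      ≡ (+ 3 + + 3 * κ) * a * b * c)

  GMNumber : ℤ → Set
  GMNumber x = ∃ λ b → ∃ λ c → GMTriple x b c ⊎' GMTriple b x c ⊎' GMTriple b c x
    where
    open import Data.Sum using () renaming (_⊎_ to _⊎'_)

  Smat : M2
  Smat = mat κ (+ 0) (+ 3 * κ * κ + + 3 * κ) κ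

  Tmat : M2
  Tmat = mat (- + 1) (+ 0) (+ 3 * κ + + 3) (- + 1)

  GCMatrix : M2 → Set
  GCMatrix P = InSL2 P × GMNumber (m12 P) × (tr P ≡ (+ 3 * κ + + 3) * m12 P - κ)

  GCTriple : M2 → M2 → M2 → Set
  GCTriple P Q R = GCMatrix P × GCMatrix Q × GCMatrix R ×
    (Q ≡ (P ⊗ R) ⊖ Smat) × GMTriple (m12 P) (m12 Q) (m12 R)

  MMMatrix : M2 → Set
  MMMatrix X = InSL2 X × GMNumber (m12 X) × (tr X ≡ - κ)

  MMTriple : M2 → M2 → M2 → Set
  MMTriple X Y Z = MMMatrix X × MMMatrix Y × MMMatrix Z ×
    ((X ⊗ Y) ⊗ Z ≡ Tmat) × GMTriple (m12 X) (m12 Y) (m12 Z)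

  ψ : M2 → M2
  ψ M = mat (- m11 M + m12 M * κ - κ)
            (m12 M)
            (m21 M - (κ + + 3) * m11 M + κ * (+ 2 * κ + + 3) * (m12 M - + 1))
            (- m22 M + (+ 2 * κ + + 3) * m12 M - κ)

  ψ⁻¹ : M2 → M2
  ψ⁻¹ N = mat a
              (m12 N)
              (m21 N + (κ + + 3) * a - κ * (+ 2 * κ + + 3) * (m12 N - + 1))
              (- m22 N + (+ 2 * κ + + 3) * m12 N - κ)
    where
    a : ℤ
    a = - m11 N + m12 N * κ - κ

  ψ-is-bijection : Set
  ψ-is-bijection = (∀ M → ψ⁻¹ (ψ M) ≡ M) × (∀ N → ψ (ψ⁻¹ N) ≡ N)

module Submission where

open import Defs
open import Data.List using ([]; _∷_)
open import Data.Nat using (ℕ)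
open import Data.Product using (_×_; _,_)
open import Data.Integer using (ℤ; +_; _+_; _-_; _*_; -_)
open import Data.Integer.Properties using (neg-involutive)
open import Data.Integer.Tactic.RingSolver using (solve)
open import Function.Bundles using (_⇔_; mk⇔; Equivalence)
open import Function.Construct.Composition using (_⇔-∘_)
open import Relation.Binary.PropositionalEquality
open ≡-Reasoning

-- On matrices of trace -κ the affine map ψ agrees with the linear bijection
-- ℓ M = L σ(M) R, where σ swaps the two diagonal entries, L = (1 0; 2κ+3 1) and
-- R = (1 0; κ 1). As σ reverses products and fixes scalars, R L = N = (1 0; 3κ+3 1)
-- and κ L R = S, this gives ℓ (Z N X - κ I) = ℓ X ℓ Z - S; so for X, Y, Z of trace -κ,
-- ψ Y = ψ X ψ Z - S iff Y = Z N X - κ I.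
-- For X, Z in SL(2,ℤ), on the other hand, X Y Z = T iff Y = adj X T adj Z, which is
-- -adj (Z N X) = Z N X - tr (Z N X) I because T = -adj N; if moreover tr Y = -κ,
-- this says again that Y = Z N X - κ I. Finally ψ and ψ⁻¹ keep the (1,2)-entry and
-- exchange the trace conditions of MM and GC matrices while preserving the determinant.

-- 2×2 integer matrices as a datatype rather than a record: matching on the
-- constructor makes nested products of matrices with variable entries normalise
-- entrywise to polynomials, which the ring solver can then compare.
data Mat : Set where
  mk : ℤ → ℤ → ℤ → ℤ → Mat

mk-cong : ∀ {a b c d a′ b′ c′ d′} → a ≡ a′ → b ≡ b′ → c ≡ c′ → d ≡ d′ →
          mk a b c d ≡ mk a′ b′ c′ d′
mk-cong refl refl refl refl = refl

infixl 7 _⊠_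
infixl 6 _⊟_

_⊠_ : Mat → Mat → Mat
mk a b c d ⊠ mk e f g h = mk (a * e + b * g) (a * f + b * h) (c * e + d * g) (c * f + d * h)

_⊟_ : Mat → Mat → Mat
mk a b c d ⊟ mk e f g h = mk (a - e) (b - f) (c - g) (d - h)

detᴹ trᴹ m₁₂ : Mat → ℤ
detᴹ (mk a b c d) = a * d - b * c
trᴹ (mk a b c d) = a + d
m₁₂ (mk a b c d) = b

scalar : ℤ → Mat
scalar t = mk t (+ 0) (+ 0) t

I : Mat
I = scalar (+ 1)

adj neg swap-diagonal : Mat → Mat
adj (mk a b c d) = mk d (- b) (- c) a
neg (mk a b c d) = mk (- a) (- b) (- c) (- d)
swap-diagonal (mk a b c d) = mk d b c a

lower : ℤ → Mat
lower t = mk (+ 1) (+ 0) t (+ 1)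

-- The ring solver proves the identities suffixed -mk, about matrices with variable
-- entries; the eliminators below extend them to all matrices. (The same proofs by
-- matching on mk make Agda's conversion checks dramatically slower.)

mk-ind : (P : Mat → Set) → (∀ a b c d → P (mk a b c d)) → ∀ M → P M
mk-ind P p (mk a b c d) = p a b c d

mk-ind₂ : (P : Mat → Mat → Set) → (∀ a b c d e f g h → P (mk a b c d) (mk e f g h)) →
          ∀ A B → P A B
mk-ind₂ P p (mk a b c d) (mk e f g h) = p a b c d e f g h

mk-ind₃ : (P : Mat → Mat → Mat → Set) →
          (∀ a b c d e f g h i j k l → P (mk a b c d) (mk e f g h) (mk i j k l)) →
          ∀ A B C → P A B C
mk-ind₃ P p (mk a b c d) (mk e f g h) (mk i j k l) = p a b c d e f g h i j k l

private
  d≡t-a : ∀ a d {t} → a + d ≡ t → d ≡ t - a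
  d≡t-a a d refl = solve (a ∷ d ∷ [])

trace-ind : ∀ t (P : Mat → Set) → (∀ a b c → P (mk a b c (t - a))) →
            ∀ M → trᴹ M ≡ t → P M
trace-ind t P p (mk a b c d) tr≡t with d≡t-a a d tr≡t
... | refl = p a b c

⊠-assoc-mk : ∀ a b c d e f g h i j k l →
             mk a b c d ⊠ mk e f g h ⊠ mk i j k l ≡ mk a b c d ⊠ (mk e f g h ⊠ mk i j k l)
⊠-assoc-mk a b c d e f g h i j k l =
  let vs = a ∷ b ∷ c ∷ d ∷ e ∷ f ∷ g ∷ h ∷ i ∷ j ∷ k ∷ l ∷ [] in
  mk-cong (solve vs) (solve vs) (solve vs) (solve vs)

⊠-assoc : ∀ A B C → A ⊠ B ⊠ C ≡ A ⊠ (B ⊠ C)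
⊠-assoc = mk-ind₃ (λ A B C → A ⊠ B ⊠ C ≡ A ⊠ (B ⊠ C)) ⊠-assoc-mk

⊠-reassoc : ∀ A B C D E → A ⊠ (B ⊠ C ⊠ D) ⊠ E ≡ A ⊠ B ⊠ C ⊠ (D ⊠ E)
⊠-reassoc A B C D E = begin
  A ⊠ (B ⊠ C ⊠ D) ⊠ E ≡⟨ cong (_⊠ E) (sym (⊠-assoc A (B ⊠ C) D)) ⟩
  A ⊠ (B ⊠ C) ⊠ D ⊠ E ≡⟨ cong (λ F → F ⊠ D ⊠ E) (sym (⊠-assoc A B C)) ⟩
  A ⊠ B ⊠ C ⊠ D ⊠ E   ≡⟨ ⊠-assoc (A ⊠ B ⊠ C) D E ⟩
  A ⊠ B ⊠ C ⊠ (D ⊠ E) ∎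

I⊠M⊠I-mk : ∀ a b c d → I ⊠ mk a b c d ⊠ I ≡ mk a b c d
I⊠M⊠I-mk a b c d =
  let vs = a ∷ b ∷ c ∷ d ∷ [] in mk-cong (solve vs) (solve vs) (solve vs) (solve vs)

I⊠M⊠I : ∀ M → I ⊠ M ⊠ I ≡ M
I⊠M⊠I = mk-ind (λ M → I ⊠ M ⊠ I ≡ M) I⊠M⊠I-mk

adj⊠M-mk : ∀ a b c d → adj (mk a b c d) ⊠ mk a b c d ≡ scalar (a * d - b * c)
adj⊠M-mk a b c d =
  let vs = a ∷ b ∷ c ∷ d ∷ [] in mk-cong (solve vs) (solve vs) (solve vs) (solve vs)

M⊠adj-mk : ∀ a b c d → mk a b c d ⊠ adj (mk a b c d) ≡ scalar (a * d - b * c)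
M⊠adj-mk a b c d =
  let vs = a ∷ b ∷ c ∷ d ∷ [] in mk-cong (solve vs) (solve vs) (solve vs) (solve vs)

adj-inverseˡ : ∀ M → detᴹ M ≡ + 1 → adj M ⊠ M ≡ I
adj-inverseˡ = mk-ind (λ M → detᴹ M ≡ + 1 → adj M ⊠ M ≡ I)
                      (λ a b c d det≡1 → trans (adj⊠M-mk a b c d) (cong scalar det≡1))

adj-inverseʳ : ∀ M → detᴹ M ≡ + 1 → M ⊠ adj M ≡ I
adj-inverseʳ = mk-ind (λ M → detᴹ M ≡ + 1 → M ⊠ adj M ≡ I)
                      (λ a b c d det≡1 → trans (M⊠adj-mk a b c d) (cong scalar det≡1))

unimodular-sandwich⇔ : ∀ X Y Z C → detᴹ X ≡ + 1 → detᴹ Z ≡ + 1 →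
                       (X ⊠ Y ⊠ Z ≡ C) ⇔ (Y ≡ adj X ⊠ C ⊠ adj Z)
unimodular-sandwich⇔ X Y Z C detX≡1 detZ≡1 = mk⇔ cancel uncancel
  where
  cancel : X ⊠ Y ⊠ Z ≡ C → Y ≡ adj X ⊠ C ⊠ adj Z
  cancel refl = begin
    Y                           ≡⟨ sym (I⊠M⊠I Y) ⟩
    I ⊠ Y ⊠ I                   ≡⟨ cong₂ (λ A B → A ⊠ Y ⊠ B) (sym (adj-inverseˡ X detX≡1))
                                                              (sym (adj-inverseʳ Z detZ≡1)) ⟩
    adj X ⊠ X ⊠ Y ⊠ (Z ⊠ adj Z) ≡⟨ sym (⊠-reassoc (adj X) X Y Z (adj Z)) ⟩
    adj X ⊠ (X ⊠ Y ⊠ Z) ⊠ adj Z ∎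
  uncancel : Y ≡ adj X ⊠ C ⊠ adj Z → X ⊠ Y ⊠ Z ≡ C
  uncancel refl = begin
    X ⊠ (adj X ⊠ C ⊠ adj Z) ⊠ Z ≡⟨ ⊠-reassoc X (adj X) C (adj Z) Z ⟩
    X ⊠ adj X ⊠ C ⊠ (adj Z ⊠ Z) ≡⟨ cong₂ (λ A B → A ⊠ C ⊠ B) (adj-inverseʳ X detX≡1)
                                                              (adj-inverseˡ Z detZ≡1) ⟩
    I ⊠ C ⊠ I                   ≡⟨ I⊠M⊠I C ⟩
    C                           ∎

cayley-hamilton-mk : ∀ a b c t → neg (adj (mk a b c (t - a))) ≡ mk a b c (t - a) ⊟ scalar t
cayley-hamilton-mk a b c t =
  let vs = a ∷ b ∷ c ∷ t ∷ [] in mk-cong (solve vs) (solve vs) (solve vs) (solve vs)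

cayley-hamilton : ∀ t M → trᴹ M ≡ t → neg (adj M) ≡ M ⊟ scalar t
cayley-hamilton t = trace-ind t (λ M → neg (adj M) ≡ M ⊟ scalar t)
                                (λ a b c → cayley-hamilton-mk a b c t)

-- If tr Y = -t, each of the two equations forces tr M = t, and then they agree.
central-form⇔ : ∀ t M Y → trᴹ Y ≡ - t → (Y ≡ neg (adj M)) ⇔ (Y ≡ M ⊟ scalar t)
central-form⇔ t M@(mk a b c d) Y trY≡-t = mk⇔ to from
  where
  to : Y ≡ neg (adj M) → Y ≡ M ⊟ scalar t
  to refl = cayley-hamilton t M (begin
    a + d         ≡⟨ solve (a ∷ d ∷ []) ⟩
    - (- d + - a) ≡⟨ cong -_ trY≡-t ⟩
    - - t         ≡⟨ neg-involutive t ⟩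
    t             ∎)
  from : Y ≡ M ⊟ scalar t → Y ≡ neg (adj M)
  from refl = sym (cayley-hamilton t M (begin
    a + d                       ≡⟨ solve (a ∷ d ∷ t ∷ []) ⟩
    (a - t) + (d - t) + (t + t) ≡⟨ cong (_+ (t + t)) trY≡-t ⟩
    - t + (t + t)               ≡⟨ solve (t ∷ []) ⟩
    t                           ∎))

module AtParameter (κ : ℤ) where

  -- Smat, Tmat, ψ and ψ⁻¹ of Defs with + k generalised to an integer κ, which the
  -- ring solver can then treat as a variable.
  Sᴹ Tᴹ : Mat
  Sᴹ = mk κ (+ 0) (+ 3 * κ * κ + + 3 * κ) κ
  Tᴹ = mk (- + 1) (+ 0) (+ 3 * κ + + 3) (- + 1)

  ψᴹ : Mat → Mat
  ψᴹ (mk a b c d) =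
    mk (- a + b * κ - κ) b (c - (κ + + 3) * a + κ * (+ 2 * κ + + 3) * (b - + 1))
       (- d + (+ 2 * κ + + 3) * b - κ)

  ψᴹ⁻¹ : Mat → Mat
  ψᴹ⁻¹ (mk p b c d) =
    let a = - p + b * κ - κ in
    mk a b (c + (κ + + 3) * a - κ * (+ 2 * κ + + 3) * (b - + 1)) (- d + (+ 2 * κ + + 3) * b - κ)

  N : Mat
  N = lower (+ 3 * κ + + 3)

  middle : Mat → Mat → Mat
  middle X Z = Z ⊠ N ⊠ X ⊟ scalar κ

  ℓ ℓ⁻¹ : Mat → Mat
  ℓ M = lower (+ 2 * κ + + 3) ⊠ swap-diagonal M ⊠ lower κ
  ℓ⁻¹ M = swap-diagonal (lower (- (+ 2 * κ + + 3)) ⊠ M ⊠ lower (- κ))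

  ψ-ψ⁻¹-mk : ∀ a b c d → ψᴹ (ψᴹ⁻¹ (mk a b c d)) ≡ mk a b c d
  ψ-ψ⁻¹-mk a b c d =
    let vs = κ ∷ a ∷ b ∷ c ∷ d ∷ [] in mk-cong (solve vs) (solve vs) (solve vs) (solve vs)

  ψ-ψ⁻¹ : ∀ M → ψᴹ (ψᴹ⁻¹ M) ≡ M
  ψ-ψ⁻¹ = mk-ind (λ M → ψᴹ (ψᴹ⁻¹ M) ≡ M) ψ-ψ⁻¹-mk

  tr-ψ-mk : ∀ a b c → trᴹ (ψᴹ (mk a b c (- κ - a))) ≡ (+ 3 * κ + + 3) * b - κ
  tr-ψ-mk a b c = begin
    (- a + b * κ - κ) + (- (- κ - a) + (+ 2 * κ + + 3) * b - κ) ≡⟨ solve (κ ∷ a ∷ b ∷ []) ⟩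
    (+ 3 * κ + + 3) * b - κ                                     ∎

  tr-ψ : ∀ M → trᴹ M ≡ - κ → trᴹ (ψᴹ M) ≡ (+ 3 * κ + + 3) * m₁₂ M - κ
  tr-ψ = trace-ind (- κ) (λ M → trᴹ (ψᴹ M) ≡ (+ 3 * κ + + 3) * m₁₂ M - κ) tr-ψ-mk

  det-ψ-mk : ∀ a b c → detᴹ (ψᴹ (mk a b c (- κ - a))) ≡ detᴹ (mk a b c (- κ - a))
  det-ψ-mk a b c = begin
    (- a + b * κ - κ) * (- (- κ - a) + (+ 2 * κ + + 3) * b - κ)
      - b * (c - (κ + + 3) * a + κ * (+ 2 * κ + + 3) * (b - + 1)) ≡⟨ solve (κ ∷ a ∷ b ∷ c ∷ []) ⟩
    a * (- κ - a) - b * c                                          ∎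

  det-ψ : ∀ M → trᴹ M ≡ - κ → detᴹ (ψᴹ M) ≡ detᴹ M
  det-ψ = trace-ind (- κ) (λ M → detᴹ (ψᴹ M) ≡ detᴹ M) det-ψ-mk

  tr-ψ⁻¹-mk : ∀ a b c → trᴹ (ψᴹ⁻¹ (mk a b c ((+ 3 * κ + + 3) * b - κ - a))) ≡ - κ
  tr-ψ⁻¹-mk a b c = begin
    (- a + b * κ - κ) + (- ((+ 3 * κ + + 3) * b - κ - a) + (+ 2 * κ + + 3) * b - κ)
      ≡⟨ solve (κ ∷ a ∷ b ∷ []) ⟩
    - κ ∎

  tr-ψ⁻¹ : ∀ M → trᴹ M ≡ (+ 3 * κ + + 3) * m₁₂ M - κ → trᴹ (ψᴹ⁻¹ M) ≡ - κ
  tr-ψ⁻¹ (mk a b c d) tr≡ with d≡t-a a d tr≡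
  ... | refl = tr-ψ⁻¹-mk a b c

  det-ψ⁻¹ : ∀ M → trᴹ M ≡ (+ 3 * κ + + 3) * m₁₂ M - κ → detᴹ (ψᴹ⁻¹ M) ≡ detᴹ M
  det-ψ⁻¹ M tr≡ = begin
    detᴹ (ψᴹ⁻¹ M)      ≡⟨ sym (det-ψ (ψᴹ⁻¹ M) (tr-ψ⁻¹ M tr≡)) ⟩
    detᴹ (ψᴹ (ψᴹ⁻¹ M)) ≡⟨ cong detᴹ (ψ-ψ⁻¹ M) ⟩
    detᴹ M             ∎

  ψ≡ℓ-mk : ∀ a b c → ψᴹ (mk a b c (- κ - a)) ≡ ℓ (mk a b c (- κ - a))
  ψ≡ℓ-mk a b c =
    let vs = κ ∷ a ∷ b ∷ c ∷ [] in mk-cong (solve vs) (solve vs) (solve vs) (solve vs)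

  ψ≡ℓ : ∀ M → trᴹ M ≡ - κ → ψᴹ M ≡ ℓ M
  ψ≡ℓ = trace-ind (- κ) (λ M → ψᴹ M ≡ ℓ M) ψ≡ℓ-mk

  ℓ⁻¹-ℓ-mk : ∀ a b c d → ℓ⁻¹ (ℓ (mk a b c d)) ≡ mk a b c d
  ℓ⁻¹-ℓ-mk a b c d =
    let vs = κ ∷ a ∷ b ∷ c ∷ d ∷ [] in mk-cong (solve vs) (solve vs) (solve vs) (solve vs)

  ℓ⁻¹-ℓ : ∀ M → ℓ⁻¹ (ℓ M) ≡ M
  ℓ⁻¹-ℓ = mk-ind (λ M → ℓ⁻¹ (ℓ M) ≡ M) ℓ⁻¹-ℓ-mk

  ℓ-injective : ∀ {X Y} → ℓ X ≡ ℓ Y → X ≡ Y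
  ℓ-injective {X} {Y} ℓX≡ℓY = begin
    X         ≡⟨ sym (ℓ⁻¹-ℓ X) ⟩
    ℓ⁻¹ (ℓ X) ≡⟨ cong ℓ⁻¹ ℓX≡ℓY ⟩
    ℓ⁻¹ (ℓ Y) ≡⟨ ℓ⁻¹-ℓ Y ⟩
    Y         ∎

  ℓ-middle-mk : ∀ a b c d e f g h →
                ℓ (middle (mk a b c d) (mk e f g h)) ≡ ℓ (mk a b c d) ⊠ ℓ (mk e f g h) ⊟ Sᴹ
  ℓ-middle-mk a b c d e f g h =
    let vs = κ ∷ a ∷ b ∷ c ∷ d ∷ e ∷ f ∷ g ∷ h ∷ [] in
    mk-cong (solve vs) (solve vs) (solve vs) (solve vs)

  ℓ-middle : ∀ X Z → ℓ (middle X Z) ≡ ℓ X ⊠ ℓ Z ⊟ Sᴹ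
  ℓ-middle = mk-ind₂ (λ X Z → ℓ (middle X Z) ≡ ℓ X ⊠ ℓ Z ⊟ Sᴹ) ℓ-middle-mk

  adj-T-adj-mk : ∀ a b c d e f g h →
                 adj (mk a b c d) ⊠ Tᴹ ⊠ adj (mk e f g h) ≡ neg (adj (mk e f g h ⊠ N ⊠ mk a b c d))
  adj-T-adj-mk a b c d e f g h =
    let vs = κ ∷ a ∷ b ∷ c ∷ d ∷ e ∷ f ∷ g ∷ h ∷ [] in
    mk-cong (solve vs) (solve vs) (solve vs) (solve vs)

  adj-T-adj : ∀ X Z → adj X ⊠ Tᴹ ⊠ adj Z ≡ neg (adj (Z ⊠ N ⊠ X))
  adj-T-adj = mk-ind₂ (λ X Z → adj X ⊠ Tᴹ ⊠ adj Z ≡ neg (adj (Z ⊠ N ⊠ X))) adj-T-adj-mk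

  XYZ≡T⇔Y≡middle : ∀ X Y Z → detᴹ X ≡ + 1 → detᴹ Z ≡ + 1 → trᴹ Y ≡ - κ →
                   (X ⊠ Y ⊠ Z ≡ Tᴹ) ⇔ (Y ≡ middle X Z)
  XYZ≡T⇔Y≡middle X Y Z detX≡1 detZ≡1 trY≡-κ =
    central-form⇔ κ (Z ⊠ N ⊠ X) Y trY≡-κ ⇔-∘
    subst (λ B → (X ⊠ Y ⊠ Z ≡ Tᴹ) ⇔ (Y ≡ B)) (adj-T-adj X Z)
          (unimodular-sandwich⇔ X Y Z Tᴹ detX≡1 detZ≡1)

  ψY≡ψXψZ-S⇔Y≡middle : ∀ X Y Z → trᴹ X ≡ - κ → trᴹ Y ≡ - κ → trᴹ Z ≡ - κ →
                        (ψᴹ Y ≡ ψᴹ X ⊠ ψᴹ Z ⊟ Sᴹ) ⇔ (Y ≡ middle X Z)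
  ψY≡ψXψZ-S⇔Y≡middle X Y Z trX≡-κ trY≡-κ trZ≡-κ = mk⇔
    (λ ψY≡ → ℓ-injective (begin
      ℓ Y              ≡⟨ sym (ψ≡ℓ Y trY≡-κ) ⟩
      ψᴹ Y             ≡⟨ ψY≡ ⟩
      ψᴹ X ⊠ ψᴹ Z ⊟ Sᴹ ≡⟨ ψXψZ-S≡ℓ-middle ⟩
      ℓ (middle X Z)   ∎))
    (λ Y≡ → begin
      ψᴹ Y             ≡⟨ ψ≡ℓ Y trY≡-κ ⟩
      ℓ Y              ≡⟨ cong ℓ Y≡ ⟩
      ℓ (middle X Z)   ≡⟨ sym ψXψZ-S≡ℓ-middle ⟩
      ψᴹ X ⊠ ψᴹ Z ⊟ Sᴹ ∎)
    where
    ψXψZ-S≡ℓ-middle : ψᴹ X ⊠ ψᴹ Z ⊟ Sᴹ ≡ ℓ (middle X Z)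
    ψXψZ-S≡ℓ-middle = begin
      ψᴹ X ⊠ ψᴹ Z ⊟ Sᴹ ≡⟨ cong₂ (λ A B → A ⊠ B ⊟ Sᴹ) (ψ≡ℓ X trX≡-κ) (ψ≡ℓ Z trZ≡-κ) ⟩
      ℓ X ⊠ ℓ Z ⊟ Sᴹ   ≡⟨ sym (ℓ-middle X Z) ⟩
      ℓ (middle X Z)   ∎

-- By computation, toMat turns ⊗, ⊖, det, tr, Smat k, Tmat k, ψ k and ψ⁻¹ k into
-- ⊠, ⊟, detᴹ, trᴹ and the AtParameter (+ k) versions of the others.
toMat : M2 → Mat
toMat P = mk (m11 P) (m12 P) (m21 P) (m22 P)

fromMat : Mat → M2
fromMat (mk a b c d) = mat a b c d

toMat-injective : ∀ {P Q} → toMat P ≡ toMat Q → P ≡ Q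
toMat-injective = cong fromMat

module _ (k : ℕ) where
  open AtParameter (+ k)

  ψ-GCMatrix : ∀ X → MMMatrix k X → GCMatrix k (ψ k X)
  ψ-GCMatrix X (det≡1 , gm , tr≡) = trans (det-ψ (toMat X) tr≡) det≡1 , gm , tr-ψ (toMat X) tr≡

  ψ⁻¹-MMMatrix : ∀ P → GCMatrix k P → MMMatrix k (ψ⁻¹ k P)
  ψ⁻¹-MMMatrix P (det≡1 , gm , tr≡) = trans (det-ψ⁻¹ (toMat P) tr≡) det≡1 , gm , tr-ψ⁻¹ (toMat P) tr≡

  ψ-GCTriple : ∀ X Y Z → MMTriple k X Y Z → GCTriple k (ψ k X) (ψ k Y) (ψ k Z)
  ψ-GCTriple X Y Z (mX@(detX≡1 , _ , trX) , mY@(_ , _ , trY) , mZ@(detZ≡1 , _ , trZ) , XYZ≡T , gm) =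
    ψ-GCMatrix X mX , ψ-GCMatrix Y mY , ψ-GCMatrix Z mZ , toMat-injective ψY≡ψXψZ-S , gm
    where
    X′ Y′ Z′ : Mat
    X′ = toMat X
    Y′ = toMat Y
    Z′ = toMat Z
    ψY≡ψXψZ-S : ψᴹ Y′ ≡ ψᴹ X′ ⊠ ψᴹ Z′ ⊟ Sᴹ
    ψY≡ψXψZ-S = Equivalence.from (ψY≡ψXψZ-S⇔Y≡middle X′ Y′ Z′ trX trY trZ)
                  (Equivalence.to (XYZ≡T⇔Y≡middle X′ Y′ Z′ detX≡1 detZ≡1 trY) (cong toMat XYZ≡T))

  ψ⁻¹-MMTriple : ∀ P Q R → GCTriple k P Q R → MMTriple k (ψ⁻¹ k P) (ψ⁻¹ k Q) (ψ⁻¹ k R)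
  ψ⁻¹-MMTriple P Q R (gP@(detP≡1 , _ , trP) , gQ@(_ , _ , trQ) , gR@(detR≡1 , _ , trR) , Q≡PR-S , gm) =
    ψ⁻¹-MMMatrix P gP , ψ⁻¹-MMMatrix Q gQ , ψ⁻¹-MMMatrix R gR , toMat-injective XYZ≡T , gm
    where
    X′ Y′ Z′ : Mat
    X′ = ψᴹ⁻¹ (toMat P)
    Y′ = ψᴹ⁻¹ (toMat Q)
    Z′ = ψᴹ⁻¹ (toMat R)
    detX′≡1 : detᴹ X′ ≡ + 1
    detX′≡1 = trans (det-ψ⁻¹ (toMat P) trP) detP≡1
    detZ′≡1 : detᴹ Z′ ≡ + 1
    detZ′≡1 = trans (det-ψ⁻¹ (toMat R) trR) detR≡1
    trX′ : trᴹ X′ ≡ - + k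
    trX′ = tr-ψ⁻¹ (toMat P) trP
    trY′ : trᴹ Y′ ≡ - + k
    trY′ = tr-ψ⁻¹ (toMat Q) trQ
    trZ′ : trᴹ Z′ ≡ - + k
    trZ′ = tr-ψ⁻¹ (toMat R) trR
    ψY≡ψXψZ-S : ψᴹ Y′ ≡ ψᴹ X′ ⊠ ψᴹ Z′ ⊟ Sᴹ
    ψY≡ψXψZ-S = begin
      ψᴹ Y′                  ≡⟨ ψ-ψ⁻¹ (toMat Q) ⟩
      toMat Q                ≡⟨ cong toMat Q≡PR-S ⟩
      toMat P ⊠ toMat R ⊟ Sᴹ ≡⟨ cong₂ (λ A B → A ⊠ B ⊟ Sᴹ) (sym (ψ-ψ⁻¹ (toMat P)))
                                                           (sym (ψ-ψ⁻¹ (toMat R))) ⟩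
      ψᴹ X′ ⊠ ψᴹ Z′ ⊟ Sᴹ     ∎
    XYZ≡T : X′ ⊠ Y′ ⊠ Z′ ≡ Tᴹ
    XYZ≡T = Equivalence.from (XYZ≡T⇔Y≡middle X′ Y′ Z′ detX′≡1 detZ′≡1 trY′)
              (Equivalence.to (ψY≡ψXψZ-S⇔Y≡middle X′ Y′ Z′ trX′ trY′ trZ′) ψY≡ψXψZ-S)

proposition5p4 : (k : ℕ) →
    ((X Y Z : M2) → MMTriple k X Y Z → GCTriple k (ψ k X) (ψ k Y) (ψ k Z)) ×
    ((P Q R : M2) → GCTriple k P Q R → MMTriple k (ψ⁻¹ k P) (ψ⁻¹ k Q) (ψ⁻¹ k R))
proposition5p4 k = ψ-GCTriple k , ψ⁻¹-MMTriple k
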